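{- For every graph $G$, $\mathrm{mw}_{\chi(G)}(G)\leq \chi(G)$.
   Context: All graphs are finite, simple and undirected; $\chi(G)$ is the chromatic number. For vertices $u,v$ of a connected graph, $I(u,v)$ is the set of vertices on shortest $(u,v)$-paths; a vertex set $S$ is convex if $I(u,v)\subseteq S$ for all $u,v\in S$. A median graph is a connected graph $M$ with $|I(u,v)\cap I(v,w)\cap I(w,u)|=1$ for all vertices $u,v,w$. The tree dimension of a graph is the minimum $k$ such that it admits a distance-preserving embedding into a Cartesian product of $k$ trees. A median decomposition of $G$ is a pair $(M,\mathcal{X})$ with $M$ a median graph and $\mathcal{X}=(X_a)_{a\in V(M)}$ subsets of $V(G)$ such that (M1) every edge of $G$ has both ends in some $X_a$, and (M2) for every $v\in V(G)$, $\{a: v\in X_a\}$ is non-empty and convex in $M$; its width is $\max_a|X_a|$. An $i$-median decomposition is one whose median graph has tree dimension at most $i$; $\mathrm{mw}_i(G)$ is the minimum width of an $i$-median decomposition of $G$. -}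

module Defs where

open import Data.Nat using (ℕ; zero; suc; _≤_)
open import Data.Fin using (Fin; zero; suc; fromℕ; inject₁)
open import Data.Fin.Subset using (Subset; _∈_; ∣_∣)
open import Data.Product using (Σ; ∃; _×_; _,_)
open import Relation.Binary.PropositionalEquality using (_≡_; _≢_)
open import Relation.Nullary using (¬_)

record Graph : Set₁ where
  field
    n     : ℕ
    Adj   : Fin n → Fin n → Set
    sym   : ∀ {u v} → Adj u v → Adj v u
    irrefl : ∀ {u} → ¬ Adj u u
open Graph public

record Walk {V : Set} (R : V → V → Set) (u v : V) (k : ℕ) : Set where
  field
    f     : Fin (suc k) → V
    start : f zero ≡ u
    end   : f (fromℕ k) ≡ v
    step  : ∀ (i : Fin k) → R (f (inject₁ i)) (f (suc i))
open Walk public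

Connected : {V : Set} → (V → V → Set) → Set
Connected R = ∀ u v → ∃ λ k → Walk R u v k

Dist : {V : Set} → (V → V → Set) → V → V → ℕ → Set
Dist R u v d = Walk R u v d × (∀ k → Walk R u v k → d ≤ k)

InInterval : {V : Set} → (V → V → Set) → V → V → V → Set
InInterval R u v w =
  Σ ℕ λ d → Dist R u v d × Σ (Walk R u v d) λ p → ∃ λ i → f p i ≡ w

Convex : {V : Set} → (V → V → Set) → (V → Set) → Set
Convex R S = ∀ u v w → S u → S v → InInterval R u v w → S w

IsMedianGraph : Graph → Set
IsMedianGraph M =
  Connected (Adj M) ×
  (∀ u v w → Σ (Fin (n M)) λ x → Med u v w x × (∀ y → Med u v w y → y ≡ x))
  where
  Med : Fin (n M) → Fin (n M) → Fin (n M) → Fin (n M) → Set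
  Med u v w x = InInterval (Adj M) u v x × InInterval (Adj M) v w x × InInterval (Adj M) w u x

HasCycle : Graph → Set
HasCycle T = Σ ℕ λ k → 3 ≤ k × Σ (Fin (suc k) → Fin (n T)) λ g →
  (g zero ≡ g (fromℕ k)) ×
  (∀ (i : Fin k) → Adj T (g (inject₁ i)) (g (suc i))) ×
  (∀ (i j : Fin k) → g (inject₁ i) ≡ g (inject₁ j) → i ≡ j)

IsTree : Graph → Set
IsTree T = Connected (Adj T) × ¬ HasCycle T

ProdV : {k : ℕ} → (Fin k → Graph) → Set
ProdV {k} T = (j : Fin k) → Fin (n (T j))

ProdAdj : {k : ℕ} → (T : Fin k → Graph) → ProdV T → ProdV T → Set
ProdAdj {k} T x y = Σ (Fin k) λ i → Adj (T i) (x i) (y i) × (∀ j → j ≢ i → x j ≡ y j)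

TreeDimAtMost : Graph → ℕ → Set₁
TreeDimAtMost M i =
  Σ ℕ λ k → k ≤ i × Σ (Fin k → Graph) λ T → (∀ j → IsTree (T j)) ×
  Σ (Fin (n M) → ProdV T) λ φ →
    ∀ a b d → (Dist (Adj M) a b d → Dist (ProdAdj T) (φ a) (φ b) d) ×
              (Dist (ProdAdj T) (φ a) (φ b) d → Dist (Adj M) a b d)

record MedianDecomposition (G : Graph) (i : ℕ) : Set₁ where
  field
    M        : Graph
    median   : IsMedianGraph M
    treeDim  : TreeDimAtMost M i
    X        : Fin (n M) → Subset (n G)
    M1       : ∀ u v → Adj G u v → ∃ λ a → u ∈ X a × v ∈ X a
    M2-nonempty : ∀ v → ∃ λ a → v ∈ X a
    M2-convex   : ∀ v → Convex (Adj M) (λ a → v ∈ X a)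
open MedianDecomposition public

width≤ : {G : Graph} {i : ℕ} → MedianDecomposition G i → ℕ → Set
width≤ D w = ∀ a → ∣ X D a ∣ ≤ w

-- mw_i(G) ≤ w  (the minimum width is ≤ w iff some decomposition has width ≤ w)
mw≤ : Graph → ℕ → ℕ → Set₁
mw≤ G i w = Σ (MedianDecomposition G i) λ D → width≤ D w

Colourable : Graph → ℕ → Set
Colourable G k = Σ (Fin (n G) → Fin k) λ c → ∀ u v → Adj G u v → c u ≢ c v

IsChromaticNumber : Graph → ℕ → Set
IsChromaticNumber G k = Colourable G k × (∀ j → Colourable G j → k ≤ j)

-- Colour G properly with k colours and let M be the k-th Cartesian power of the star whose
-- leaves are the vertices of G; M is a median graph of tree dimension at most k. A vertex a
-- of M picks, for each colour j, the hub or a leaf of the j-th star, and its bag is the set of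
-- vertices v with a (c v) the leaf v. Each colour contributes at most one vertex, so bags have at
-- most k elements; the ends of an edge uv have different colours, so one vertex of M places
-- both; and since intervals in M are products of intervals in the stars, while the only
-- vertex between leaf v and itself is v, the vertices of M whose bag contains v form a
-- convex set. Distances are handled through explicit distance functions (the sum of the
-- coordinate distances on M), whose descent property yields geodesics and identifies
-- intervals with the vertices where the triangle inequality is tight.

module Submission where

open import Data.Bool using (if_then_else_)
open import Data.Empty using () renaming (⊥ to Empty)
open import Data.Fin using (Fin; zero; suc; fromℕ; inject₁; toℕ; finToFun; funToFin; combine)
open import Data.Fin.Patterns using (0F; 1F; 2F; 3F)
open import Data.Fin.Properties using (toℕ≤pred[n]; funToFin-finToFin; finToFun-funToFin)
import Data.Fin.Properties as Fin
open import Data.Fin.Subset using (Subset; _∈_; ∣_∣; _∪_; ⁅_⁆; ⊥; inside; outside)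
open import Data.Fin.Subset.Properties using (x∈p∪q⁺; x∈⁅x⁆; ∣⁅x⁆∣≡1; ∣⊥∣≡0; p⊆q⇒∣p∣≤∣q∣)
open import Data.Nat using (ℕ; zero; suc; _+_; _∸_; _^_; _≤_; z≤n; s≤s)
open import Data.Nat.Properties
open import Algebra.Properties.CommutativeMonoid.Sum +-0-commutativeMonoid
  using (sum; sum-cong-≗; ∑-distrib-+; sum-replicate-zero)
open import Data.Product using (Σ; ∃; _×_; _,_; proj₁; proj₂)
open import Data.Sum using (_⊎_; inj₁; inj₂)
open import Data.Vec using (_∷_; []; tabulate)
open import Data.Vec.Properties using (lookup∘tabulate; []=⇒lookup; lookup⇒[]=)
import Data.Vec.Functional as Vector
open import Data.Vec.Functional using (updateAt)
open import Data.Vec.Functional.Properties using (updateAt-updates; updateAt-minimal)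
open import Function using (_∘_; _on_; _⇔_; mk⇔; Equivalence)
open import Relation.Binary.PropositionalEquality
open import Relation.Nullary using (¬_; yes; no; does; contradiction)
open import Relation.Nullary.Decidable using (dec-true)
open import Relation.Unary using (Decidable)

open import Defs hiding (sym; median)

Between : {V : Set} → (V → V → ℕ) → V → V → V → Set
Between D x y w = D x w + D w y ≡ D x y

IsMedian : {V : Set} → (V → V → ℕ) → V → V → V → V → Set
IsMedian D x y z w = Between D x y w × Between D y z w × Between D z x w

Steps : {V : Set} → (V → V → Set) → ∀ {k} → (Fin (suc k) → V) → Set
Steps R {k} g = ∀ (i : Fin k) → R (g (inject₁ i)) (g (suc i))

-- Such a D is the graph distance of R (Dist⇔≡): it drops by at most one along every edge and
-- by exactly one along some edge.
record IsDistance {V : Set} (R : V → V → Set) (D : V → V → ℕ) : Set where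
  field
    D-refl    : ∀ x → D x x ≡ 0
    D-zero    : ∀ {x y} → D x y ≡ 0 → x ≡ y
    D-step    : ∀ {x y} z → R x y → D x z ≤ suc (D y z)
    D-descent : ∀ {x y m} → D x y ≡ suc m → ∃ λ x′ → R x x′ × D x′ y ≡ m

record MedianOperator {V : Set} (D : V → V → ℕ) : Set where
  field
    median           : V → V → V → V
    median-isMedian  : ∀ x y z → IsMedian D x y z (median x y z)
    isMedian⇒≡median : ∀ {x y z w} → IsMedian D x y z w → w ≡ median x y z

module IsDistanceProperties {V : Set} {R : V → V → Set} {D : V → V → ℕ}
                            (isDistance : IsDistance R D) where

  open IsDistance isDistance

  triangle : ∀ x y z → D x z ≤ D x y + D y z
  triangle x y z = go (D x y) refl
    where
    go : ∀ m {x} → D x y ≡ m → D x z ≤ m + D y z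
    go zero    e = ≤-reflexive (cong (λ t → D t z) (D-zero e))
    go (suc m) e with D-descent e
    ... | x′ , r , e′ = ≤-trans (D-step z r) (s≤s (go m e′))

  between-left : ∀ x y → Between D x y x
  between-left x y = cong (_+ D x y) (D-refl x)

  between-right : ∀ x y → Between D x y y
  between-right x y = trans (cong (D x y +_) (D-refl y)) (+-identityʳ _)

  between-same-ends : ∀ {x w} → Between D x x w → w ≡ x
  between-same-ends {x} b = sym (D-zero (m+n≡0⇒m≡0 _ (trans b (D-refl x))))

  dist-from-start≤ : ∀ {k} (g : Fin (suc k) → V) → Steps R g → ∀ i → D (g zero) (g i) ≤ toℕ i
  dist-from-start≤ g s zero = ≤-reflexive (D-refl _)
  dist-from-start≤ {suc k} g s (suc i) =
    ≤-trans (D-step _ (s zero)) (s≤s (dist-from-start≤ (g ∘ suc) (s ∘ suc) i))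

  dist-to-end≤ : ∀ {k} (g : Fin (suc k) → V) → Steps R g → ∀ i → D (g i) (g (fromℕ k)) ≤ k ∸ toℕ i
  dist-to-end≤ {zero}  g s zero    = ≤-reflexive (D-refl _)
  dist-to-end≤ {suc k} g s zero    =
    ≤-trans (D-step _ (s zero)) (s≤s (dist-to-end≤ (g ∘ suc) (s ∘ suc) zero))
  dist-to-end≤ {suc k} g s (suc i) = dist-to-end≤ (g ∘ suc) (s ∘ suc) i

  walk-length≥ : ∀ {u v k} → Walk R u v k → D u v ≤ k
  walk-length≥ {k = k} p =
    subst₂ (λ a b → D a b ≤ k) (start p) (end p) (dist-to-end≤ (f p) (step p) zero)

  prepend : ∀ {x x′ y k} → R x x′ → Walk R x′ y k → Walk R x y (suc k)
  prepend {x} r p = record { f = g ; start = refl ; end = end p ; step = s }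
    where
    g : Fin _ → V
    g zero    = x
    g (suc i) = f p i
    s : Steps R g
    s zero    = subst (R x) (sym (start p)) r
    s (suc i) = step p i

  geodesic : ∀ x y → Walk R x y (D x y)
  geodesic x y = go (D x y) refl
    where
    go : ∀ m {x} → D x y ≡ m → Walk R x y m
    go zero {x} e = record { f = λ _ → x ; start = refl ; end = D-zero e ; step = λ () }
    go (suc m) e with D-descent e
    ... | x′ , r , e′ = prepend r (go m e′)

  between-descent : ∀ {x x′ y w} → R x x′ → suc (D x′ w) ≡ D x w → Between D x y w →
                    suc (D x′ y) ≡ D x y × Between D x′ y w
  between-descent {x} {x′} {y} {w} r closer-to-w b = closer-to-y , suc-injective (begin
    suc (D x′ w + D w y)  ≡⟨ cong (_+ D w y) closer-to-w ⟩
    D x w + D w y         ≡⟨ b ⟩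
    D x y                 ≡⟨ closer-to-y ⟨
    suc (D x′ y)          ∎)
    where
    open ≡-Reasoning
    closer-to-y : suc (D x′ y) ≡ D x y
    closer-to-y = ≤-antisym
      (≤-trans (s≤s (triangle x′ w y)) (≤-reflexive (trans (cong (_+ D w y) closer-to-w) b)))
      (D-step y r)

  geodesic-via : ∀ {x y w} → Between D x y w → Σ (Walk R x y (D x y)) λ p → ∃ λ i → f p i ≡ w
  geodesic-via {x} {y} {w} = go (D x w) refl
    where
    go : ∀ m {x} → D x w ≡ m → Between D x y w → Σ (Walk R x y (D x y)) λ p → ∃ λ i → f p i ≡ w
    go zero {x} e b = geodesic x y , zero , trans (start (geodesic x y)) (D-zero e)
    go (suc m) {x} e b with D-descent e
    ... | x′ , r , e′ with between-descent r (trans (cong suc e′) (sym e)) b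
    ...   | closer-to-y , b′ with go m e′ b′
    ...     | p , i , pi≡w = subst (λ d → Σ (Walk R x y d) λ p → ∃ λ i → f p i ≡ w) closer-to-y
                               (prepend r p , suc i , pi≡w)

  Dist⇔≡ : ∀ {u v d} → Dist R u v d ⇔ d ≡ D u v
  Dist⇔≡ {u} {v} = mk⇔
    (λ (p , minimal) → ≤-antisym (minimal _ (geodesic u v)) (walk-length≥ p))
    (λ { refl → geodesic u v , λ _ → walk-length≥ })

  InInterval⇔Between : ∀ {u v w} → InInterval R u v w ⇔ Between D u v w
  InInterval⇔Between {u} {v} {w} = mk⇔ to from
    where
    to : InInterval R u v w → Between D u v w
    to (d , shortest , p , i , pi≡w) = ≤-antisym (begin
      D u w + D w v        ≤⟨ +-mono-≤ before-w after-w ⟩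
      toℕ i + (d ∸ toℕ i)  ≡⟨ m+[n∸m]≡n (toℕ≤pred[n] i) ⟩
      d                    ≡⟨ Equivalence.to Dist⇔≡ shortest ⟩
      D u v                ∎) (triangle u w v)
      where
      open ≤-Reasoning hiding (start)
      before-w : D u w ≤ toℕ i
      before-w = subst₂ (λ a b → D a b ≤ toℕ i) (start p) pi≡w (dist-from-start≤ (f p) (step p) i)
      after-w : D w v ≤ d ∸ toℕ i
      after-w = subst₂ (λ a b → D a b ≤ d ∸ toℕ i) pi≡w (end p) (dist-to-end≤ (f p) (step p) i)
    from : Between D u v w → InInterval R u v w
    from b with geodesic-via b
    ... | p , i , pi≡w = D u v , Equivalence.from Dist⇔≡ refl , p , i , pi≡w

  connected : Connected R
  connected u v = D u v , geodesic u v

  InIntervals⇔IsMedian : ∀ {x y z w} →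
    (InInterval R x y w × InInterval R y z w × InInterval R z x w) ⇔ IsMedian D x y z w
  InIntervals⇔IsMedian = mk⇔
    (λ (i₁ , i₂ , i₃) → to i₁ , to i₂ , to i₃) (λ (b₁ , b₂ , b₃) → from b₁ , from b₂ , from b₃)
    where
    to : ∀ {u v w} → InInterval R u v w → Between D u v w
    to = Equivalence.to InInterval⇔Between
    from : ∀ {u v w} → Between D u v w → InInterval R u v w
    from = Equivalence.from InInterval⇔Between

medianOperator⇒isMedianGraph : (M : Graph) {D : Fin (n M) → Fin (n M) → ℕ} →
                               IsDistance (Adj M) D → MedianOperator D → IsMedianGraph M
medianOperator⇒isMedianGraph M isDistance medianOperator = connected , λ x y z →
  median x y z , Equivalence.from InIntervals⇔IsMedian (median-isMedian x y z) ,
  λ w inIntervals → isMedian⇒≡median (Equivalence.to InIntervals⇔IsMedian inIntervals)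
  where
  open IsDistanceProperties isDistance
  open MedianOperator medianOperator

module _ {W V : Set} (R : V → V → Set) (φ : W → V) (ψ : V → W)
         (ψ∘φ≗id : ∀ a → ψ (φ a) ≡ a)
         (R-resp-φ∘ψ : ∀ {x y} → R x y → R (φ (ψ x)) (φ (ψ y))) where

  walk-push : ∀ {a b k} → Walk (R on φ) a b k → Walk R (φ a) (φ b) k
  walk-push p =
    record { f = φ ∘ f p ; start = cong φ (start p) ; end = cong φ (end p) ; step = step p }

  walk-pull : ∀ {a b k} → Walk R (φ a) (φ b) k → Walk (R on φ) a b k
  walk-pull {a} {b} p = record
    { f     = ψ ∘ f p
    ; start = trans (cong ψ (start p)) (ψ∘φ≗id a)
    ; end   = trans (cong ψ (end p)) (ψ∘φ≗id b)
    ; step  = R-resp-φ∘ψ ∘ step p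
    }

  Dist-on⇔ : ∀ {a b d} → Dist (R on φ) a b d ⇔ Dist R (φ a) (φ b) d
  Dist-on⇔ = mk⇔ (λ (p , minimal) → walk-push p , λ k → minimal k ∘ walk-pull)
                 (λ (p , minimal) → walk-pull p , λ k → minimal k ∘ walk-push)

sum-mono-≤ : ∀ {k} {f g : Fin k → ℕ} → (∀ j → f j ≤ g j) → sum f ≤ sum g
sum-mono-≤ {zero}  _   = z≤n
sum-mono-≤ {suc k} f≤g = +-mono-≤ (f≤g zero) (sum-mono-≤ (f≤g ∘ suc))

sum≤sum⇒≗ : ∀ {k} {f g : Fin k → ℕ} → (∀ j → f j ≤ g j) → sum g ≤ sum f → f ≗ g
sum≤sum⇒≗ {suc k} {f} {g} f≤g g≤f zero = ≤-antisym (f≤g zero)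
  (+-cancelʳ-≤ (sum (g ∘ suc)) _ _ (≤-trans g≤f (+-monoʳ-≤ (f zero) (sum-mono-≤ (f≤g ∘ suc)))))
sum≤sum⇒≗ {suc k} {f} {g} f≤g g≤f (suc j) = sum≤sum⇒≗ (f≤g ∘ suc)
  (+-cancelˡ-≤ (f zero) _ _ (≤-trans (+-monoˡ-≤ (sum (g ∘ suc)) (f≤g zero)) g≤f)) j

sum≡0⇒≡0 : ∀ {k} {f : Fin k → ℕ} → sum f ≡ 0 → ∀ j → f j ≡ 0
sum≡0⇒≡0 sum≡0 j = sym (sum≤sum⇒≗ (λ _ → z≤n) (≤-trans (≤-reflexive sum≡0) z≤n) j)

sum≤suc-sum : ∀ {k} {f g : Fin k → ℕ} i → (∀ j → j ≢ i → f j ≤ g j) → f i ≤ suc (g i) →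
              sum f ≤ suc (sum g)
sum≤suc-sum zero    f≤g fi≤ = +-mono-≤ fi≤ (sum-mono-≤ (λ j → f≤g (suc j) (λ ())))
sum≤suc-sum {suc k} {f} {g} (suc i) f≤g fi≤ = ≤-trans
  (+-mono-≤ (f≤g zero (λ ())) (sum≤suc-sum i (λ j j≢i → f≤g (suc j) (j≢i ∘ Fin.suc-injective)) fi≤))
  (≤-reflexive (+-suc (g zero) (sum (g ∘ suc))))

funToFin-cong : ∀ {m n} {f g : Fin m → Fin n} → f ≗ g → funToFin f ≡ funToFin g
funToFin-cong {zero}  _   = refl
funToFin-cong {suc m} f≗g = cong₂ combine (f≗g zero) (funToFin-cong (f≗g ∘ suc))

∣p∪q∣≤∣p∣+∣q∣ : ∀ {n} (p q : Subset n) → ∣ p ∪ q ∣ ≤ ∣ p ∣ + ∣ q ∣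
∣p∪q∣≤∣p∣+∣q∣ []            []            = z≤n
∣p∪q∣≤∣p∣+∣q∣ (inside  ∷ p) (inside  ∷ q) =
  s≤s (≤-trans (∣p∪q∣≤∣p∣+∣q∣ p q) (+-monoʳ-≤ ∣ p ∣ (n≤1+n ∣ q ∣)))
∣p∪q∣≤∣p∣+∣q∣ (inside  ∷ p) (outside ∷ q) = s≤s (∣p∪q∣≤∣p∣+∣q∣ p q)
∣p∪q∣≤∣p∣+∣q∣ (outside ∷ p) (inside  ∷ q) =
  ≤-trans (s≤s (∣p∪q∣≤∣p∣+∣q∣ p q)) (≤-reflexive (sym (+-suc ∣ p ∣ ∣ q ∣)))
∣p∪q∣≤∣p∣+∣q∣ (outside ∷ p) (outside ∷ q) = ∣p∪q∣≤∣p∣+∣q∣ p q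

∈-tabulate⇔ : ∀ {n} {P : Fin n → Set} (P? : Decidable P) {v} → v ∈ tabulate (does ∘ P?) ⇔ P v
∈-tabulate⇔ {P = P} P? {v} = mk⇔ to
  (λ Pv → lookup⇒[]= v _ (trans (lookup∘tabulate (does ∘ P?) v) (dec-true (P? v) Pv)))
  where
  to : v ∈ tabulate (does ∘ P?) → P v
  to v∈ with P? v | trans (sym (lookup∘tabulate (does ∘ P?) v)) ([]=⇒lookup v∈)
  ... | yes Pv | _ = Pv

module Star (N : ℕ) where

  data StarAdj : Fin (suc N) → Fin (suc N) → Set where
    hub-leaf : ∀ {v} → StarAdj zero (suc v)
    leaf-hub : ∀ {v} → StarAdj (suc v) zero

  StarAdj-sym : ∀ {x y} → StarAdj x y → StarAdj y x
  StarAdj-sym hub-leaf = leaf-hub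
  StarAdj-sym leaf-hub = hub-leaf

  StarAdj-irrefl : ∀ {x} → ¬ StarAdj x x
  StarAdj-irrefl ()

  star : Graph
  star = record { n = suc N ; Adj = StarAdj ; sym = StarAdj-sym ; irrefl = StarAdj-irrefl }

  starDist : Fin (suc N) → Fin (suc N) → ℕ
  starDist zero    zero    = 0
  starDist zero    (suc _) = 1
  starDist (suc _) zero    = 1
  starDist (suc u) (suc v) = if does (u Fin.≟ v) then 0 else 2

  starDist≤2 : ∀ x y → starDist x y ≤ 2
  starDist≤2 zero    zero    = z≤n
  starDist≤2 zero    (suc _) = s≤s z≤n
  starDist≤2 (suc _) zero    = s≤s z≤n
  starDist≤2 (suc u) (suc v) with u Fin.≟ v
  ... | yes _ = z≤n
  ... | no  _ = ≤-refl

  starDist-isDistance : IsDistance StarAdj starDist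
  starDist-isDistance = record
    { D-refl = D-refl ; D-zero = D-zero ; D-step = D-step ; D-descent = D-descent }
    where
    D-refl : ∀ x → starDist x x ≡ 0
    D-refl zero = refl
    D-refl (suc u) with u Fin.≟ u
    ... | yes _   = refl
    ... | no  u≢u = contradiction refl u≢u

    D-zero : ∀ {x y} → starDist x y ≡ 0 → x ≡ y
    D-zero {zero}  {zero}  _ = refl
    D-zero {suc u} {suc v} e with u Fin.≟ v
    ... | yes u≡v = cong suc u≡v

    D-step : ∀ {x y} z → StarAdj x y → starDist x z ≤ suc (starDist y z)
    D-step zero    hub-leaf = z≤n
    D-step (suc _) hub-leaf = s≤s z≤n
    D-step zero    leaf-hub = s≤s z≤n
    D-step (suc w) (leaf-hub {v}) = starDist≤2 (suc v) (suc w)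

    D-descent : ∀ {x y m} → starDist x y ≡ suc m → ∃ λ x′ → StarAdj x x′ × starDist x′ y ≡ m
    D-descent {zero}  {suc v} refl = suc v , hub-leaf , D-refl (suc v)
    D-descent {suc u} {zero}  refl = zero , leaf-hub , refl
    D-descent {suc u} {suc v} e with u Fin.≟ v
    D-descent {suc u} {suc v} refl | no _ = zero , leaf-hub , refl

  open IsDistanceProperties starDist-isDistance

  star-isTree : IsTree star
  star-isTree = connected , acyclic
    where
    through-leaf : ∀ {x y z} → StarAdj x y → StarAdj y z → x ≡ z ⊎ y ≡ zero
    through-leaf hub-leaf leaf-hub = inj₁ refl
    through-leaf leaf-hub hub-leaf = inj₂ refl

    revisit : ∀ k (g : Fin (4 + k) → Fin (suc N)) →
              (∀ (i j : Fin (3 + k)) → g (inject₁ i) ≡ g (inject₁ j) → i ≡ j) →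
              g 1F ≡ g 3F → g 0F ≡ g (fromℕ (3 + k)) → Empty
    revisit zero    g distinct g₁≡g₃ g₀≡g₃ with distinct 1F 0F (trans g₁≡g₃ (sym g₀≡g₃))
    ... | ()
    revisit (suc k) g distinct g₁≡g₃ _     with distinct 1F 3F g₁≡g₃
    ... | ()

    -- Every second vertex of a cycle is the hub, so g 0 ≡ g 2 or g 1 ≡ g 3.
    acyclic : ¬ HasCycle star
    acyclic (suc (suc (suc k)) , _ , g , closed , st , distinct)
      with through-leaf (st 0F) (st 1F)
    ... | inj₁ g₀≡g₂ with distinct 0F 2F g₀≡g₂
    ...   | ()
    acyclic (suc (suc (suc k)) , _ , g , closed , st , distinct) | inj₂ g₁≡hub
      with through-leaf (st 1F) (st 2F)
    ... | inj₂ g₂≡hub = StarAdj-irrefl (subst₂ StarAdj (trans g₁≡hub (sym g₂≡hub)) refl (st 1F))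
    ... | inj₁ g₁≡g₃ = revisit k g distinct g₁≡g₃ closed
    acyclic (1 , s≤s () , _)
    acyclic (2 , s≤s (s≤s ()) , _)

  leaf-between : ∀ {x y} v → Between starDist x y (suc v) → suc v ≡ x ⊎ suc v ≡ y
  leaf-between {zero}  {suc u} v b with v Fin.≟ u
  ... | yes refl = inj₂ refl
  leaf-between {suc u} {y}     v b with u Fin.≟ v
  ... | yes refl = inj₁ refl
  leaf-between {suc u} {suc w} v b | no _ with v Fin.≟ w | u Fin.≟ w
  ... | yes refl | _     = inj₂ refl
  leaf-between {suc u} {suc w} v () | no _ | no _ | yes _
  leaf-between {suc u} {suc w} v () | no _ | no _ | no _

  hub-between : ∀ {x y} → x ≢ y → Between starDist x y zero
  hub-between {zero}          _   = refl
  hub-between {suc u} {zero}  _   = refl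
  hub-between {suc u} {suc v} x≢y with u Fin.≟ v
  ... | yes u≡v = contradiction (cong suc u≡v) x≢y
  ... | no  _   = refl

  leaf-not-median : ∀ {x y z} v → x ≢ y → y ≢ z → z ≢ x → ¬ IsMedian starDist x y z (suc v)
  leaf-not-median v x≢y y≢z z≢x (b₁ , b₂ , b₃)
    with leaf-between v b₁ | leaf-between v b₂ | leaf-between v b₃
  ... | inj₁ w≡x | inj₁ w≡y | _        = x≢y (trans (sym w≡x) w≡y)
  ... | inj₁ w≡x | inj₂ w≡z | _        = z≢x (trans (sym w≡z) w≡x)
  ... | inj₂ w≡y | _        | inj₁ w≡z = y≢z (trans (sym w≡y) w≡z)
  ... | inj₂ w≡y | _        | inj₂ w≡x = x≢y (trans (sym w≡x) w≡y)

  starMedian : Fin (suc N) → Fin (suc N) → Fin (suc N) → Fin (suc N)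
  starMedian x y z with x Fin.≟ y | y Fin.≟ z | z Fin.≟ x
  ... | yes _ | _     | _     = x
  ... | no _  | yes _ | _     = y
  ... | no _  | no _  | yes _ = z
  ... | no _  | no _  | no _  = zero

  starMedian-operator : MedianOperator starDist
  starMedian-operator = record
    { median = starMedian ; median-isMedian = isMedian ; isMedian⇒≡median = unique }
    where
    isMedian : ∀ x y z → IsMedian starDist x y z (starMedian x y z)
    isMedian x y z with x Fin.≟ y | y Fin.≟ z | z Fin.≟ x
    ... | yes refl | _        | _        = between-left x x , between-left x z , between-right z x
    ... | no _     | yes refl | _        = between-right x y , between-left y y , between-left y x
    ... | no _     | no _     | yes refl = between-left z y , between-right y z , between-left z z
    ... | no x≢y   | no y≢z   | no z≢x   = hub-between x≢y , hub-between y≢z , hub-between z≢x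

    unique : ∀ {x y z w} → IsMedian starDist x y z w → w ≡ starMedian x y z
    unique {x} {y} {z} {w} (b₁ , b₂ , b₃) with x Fin.≟ y | y Fin.≟ z | z Fin.≟ x
    ... | yes refl | _        | _        = between-same-ends b₁
    ... | no _     | yes refl | _        = between-same-ends b₂
    ... | no _     | no _     | yes refl = between-same-ends b₃
    ... | no x≢y   | no y≢z   | no z≢x   with w
    ...   | zero  = refl
    ...   | suc v = contradiction (b₁ , b₂ , b₃) (leaf-not-median v x≢y y≢z z≢x)

  leaf : Fin (suc N) → Subset N
  leaf zero    = ⊥
  leaf (suc v) = ⁅ v ⁆

  leaves : ∀ {k} → (Fin k → Fin (suc N)) → Subset N
  leaves {zero}  _ = ⊥
  leaves {suc k} x = leaf (x zero) ∪ leaves (x ∘ suc)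

  ∣leaves∣≤ : ∀ {k} (x : Fin k → Fin (suc N)) → ∣ leaves x ∣ ≤ k
  ∣leaves∣≤ {zero}  _ = ≤-reflexive (∣⊥∣≡0 N)
  ∣leaves∣≤ {suc k} x = ≤-trans (∣p∪q∣≤∣p∣+∣q∣ (leaf (x zero)) (leaves (x ∘ suc)))
                                 (+-mono-≤ (∣leaf∣≤1 (x zero)) (∣leaves∣≤ (x ∘ suc)))
    where
    ∣leaf∣≤1 : ∀ x → ∣ leaf x ∣ ≤ 1
    ∣leaf∣≤1 zero    = ≤-trans (≤-reflexive (∣⊥∣≡0 N)) z≤n
    ∣leaf∣≤1 (suc v) = ≤-reflexive (∣⁅x⁆∣≡1 v)

  ∈leaves : ∀ {k} (x : Fin k → Fin (suc N)) {v} j → x j ≡ suc v → v ∈ leaves x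
  ∈leaves x zero    xj≡v = x∈p∪q⁺ (inj₁ (subst (λ t → _ ∈ leaf t) (sym xj≡v) (x∈⁅x⁆ _)))
  ∈leaves x (suc j) xj≡v = x∈p∪q⁺ {p = leaf (x zero)} (inj₂ (∈leaves (x ∘ suc) j xj≡v))

module Power (H : Graph) {D : Fin (n H) → Fin (n H) → ℕ} (isDistance : IsDistance (Adj H) D) where

  open IsDistance isDistance
  open IsDistanceProperties isDistance using (triangle)

  PowerAdj : ∀ {k} → (Fin k → Fin (n H)) → (Fin k → Fin (n H)) → Set
  PowerAdj = ProdAdj (λ _ → H)

  PowerAdj-resp-≗ : ∀ {k} {x x′ y y′ : Fin k → Fin (n H)} →
                    x ≗ x′ → y ≗ y′ → PowerAdj x y → PowerAdj x′ y′
  PowerAdj-resp-≗ x≗x′ y≗y′ (i , r , same) = i , subst₂ (Adj H) (x≗x′ i) (y≗y′ i) r ,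
    λ j j≢i → trans (sym (x≗x′ j)) (trans (same j j≢i) (y≗y′ j))

  sumDist : ∀ {k} → (Fin k → Fin (n H)) → (Fin k → Fin (n H)) → ℕ
  sumDist x y = sum (λ j → D (x j) (y j))

  sumDist-refl : ∀ {k} (x : Fin k → Fin (n H)) → sumDist x x ≡ 0
  sumDist-refl {k} x = trans (sum-cong-≗ (D-refl ∘ x)) (sum-replicate-zero k)

  sumDist-zero : ∀ {k} {x y : Fin k → Fin (n H)} → sumDist x y ≡ 0 → x ≗ y
  sumDist-zero e j = D-zero (sum≡0⇒≡0 e j)

  sumDist-step : ∀ {k} {x y : Fin k → Fin (n H)} z → PowerAdj x y → sumDist x z ≤ suc (sumDist y z)
  sumDist-step z (i , r , same) =
    sum≤suc-sum i (λ j j≢i → ≤-reflexive (cong (λ t → D t (z j)) (same j j≢i))) (D-step (z i) r)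

  sumDist-descent : ∀ {k} {x y : Fin k → Fin (n H)} {m} → sumDist x y ≡ suc m →
                    ∃ λ x′ → PowerAdj x x′ × sumDist x′ y ≡ m
  sumDist-descent {suc k} {x} {y} e with D (x zero) (y zero) in e₀
  ... | suc _ with D-descent e₀
  ...   | s , r , e′ = s Vector.∷ x ∘ suc , (zero , r , same) ,
                         trans (cong (_+ sumDist (x ∘ suc) (y ∘ suc)) e′) (suc-injective e)
    where
    same : ∀ j → j ≢ zero → x j ≡ (s Vector.∷ x ∘ suc) j
    same zero    0≢0 = contradiction refl 0≢0
    same (suc j) _   = refl
  sumDist-descent {suc k} {x} {y} e | zero with sumDist-descent {x = x ∘ suc} {y ∘ suc} e
  ... | x″ , (i , r , same) , e′ = x zero Vector.∷ x″ , (suc i , r , same′) ,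
                                   trans (cong (_+ sumDist x″ (y ∘ suc)) e₀) e′
    where
    same′ : ∀ j → j ≢ suc i → x j ≡ (x zero Vector.∷ x″) j
    same′ zero    _   = refl
    same′ (suc j) j≢i = same j (j≢i ∘ cong suc)

  Between-sumDist⇔ : ∀ {k} {x y w : Fin k → Fin (n H)} →
                     Between sumDist x y w ⇔ (∀ j → Between D (x j) (y j) (w j))
  Between-sumDist⇔ {x = x} {y} {w} = mk⇔
    (λ b j → sym (sum≤sum⇒≗ (λ j → triangle (x j) (w j) (y j)) (≤-reflexive (trans sum-split b)) j))
    (λ b → trans (sym sum-split) (sum-cong-≗ b))
    where
    sum-split : sum (λ j → D (x j) (w j) + D (w j) (y j)) ≡ sumDist x w + sumDist w y
    sum-split = ∑-distrib-+ (λ j → D (x j) (w j)) (λ j → D (w j) (y j))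

  module _ (k : ℕ) where

    -- A Graph has vertex set Fin n, so the power is encoded in Fin (n H ^ k). Only the encoded
    -- graph has an IsDistance structure: on functions, sumDist x y ≡ 0 yields x ≗ y but not
    -- x ≡ y, so distances in ProdAdj are compared with it through walks (Dist-on⇔).
    coords : Fin (n H ^ k) → (Fin k → Fin (n H))
    coords = finToFun

    encode : (Fin k → Fin (n H)) → Fin (n H ^ k)
    encode = funToFin

    coords∘encode≗id : ∀ x → coords (encode x) ≗ x
    coords∘encode≗id = finToFun-funToFin

    encode∘coords≗id : ∀ a → encode (coords a) ≡ a
    encode∘coords≗id = funToFin-finToFin {k}

    coords-injective : ∀ {a b} → coords a ≗ coords b → a ≡ b
    coords-injective {a} {b} a≗b = begin
      a                    ≡⟨ encode∘coords≗id a ⟨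
      encode (coords a)    ≡⟨ funToFin-cong a≗b ⟩
      encode (coords b)    ≡⟨ encode∘coords≗id b ⟩
      b                    ∎
      where open ≡-Reasoning

    powerGraph : Graph
    powerGraph = record
      { n      = n H ^ k
      ; Adj    = PowerAdj on coords
      ; sym    = λ (i , r , same) → i , Graph.sym H r , λ j j≢i → sym (same j j≢i)
      ; irrefl = λ (_ , r , _) → Graph.irrefl H r
      }

    powerDist : Fin (n H ^ k) → Fin (n H ^ k) → ℕ
    powerDist = sumDist on coords

    PowerAdj-resp-coords∘encode : ∀ {x y} → PowerAdj x y →
                                  PowerAdj (coords (encode x)) (coords (encode y))
    PowerAdj-resp-coords∘encode {x} {y} =
      PowerAdj-resp-≗ (sym ∘ coords∘encode≗id x) (sym ∘ coords∘encode≗id y)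

    powerDist-isDistance : IsDistance (Adj powerGraph) powerDist
    powerDist-isDistance = record
      { D-refl    = sumDist-refl ∘ coords
      ; D-zero    = coords-injective ∘ sumDist-zero
      ; D-step    = sumDist-step ∘ coords
      ; D-descent = descent
      }
      where
      descent : ∀ {a b m} → powerDist a b ≡ suc m → ∃ λ a′ → Adj powerGraph a a′ × powerDist a′ b ≡ m
      descent {a} {b} e with sumDist-descent e
      ... | x , r , e′ = encode x , PowerAdj-resp-≗ (λ _ → refl) (sym ∘ coords∘encode≗id x) r ,
                         trans (sum-cong-≗ λ j → cong (λ t → D t (coords b j)) (coords∘encode≗id x j)) e′

    Between-powerDist⇔ : ∀ {a b w} →
      Between powerDist a b w ⇔ (∀ j → Between D (coords a j) (coords b j) (coords w j))
    Between-powerDist⇔ = Between-sumDist⇔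

    IsMedian-powerDist⇔ : ∀ {a b c w} → IsMedian powerDist a b c w ⇔
      (∀ j → IsMedian D (coords a j) (coords b j) (coords c j) (coords w j))
    IsMedian-powerDist⇔ = mk⇔
      (λ (b₁ , b₂ , b₃) j → to b₁ j , to b₂ j , to b₃ j)
      (λ m → from (proj₁ ∘ m) , from (proj₁ ∘ proj₂ ∘ m) , from (proj₂ ∘ proj₂ ∘ m))
      where
      to : ∀ {x y w} → Between powerDist x y w → ∀ j → Between D (coords x j) (coords y j) (coords w j)
      to = Equivalence.to Between-powerDist⇔
      from : ∀ {x y w} → (∀ j → Between D (coords x j) (coords y j) (coords w j)) → Between powerDist x y w
      from = Equivalence.from Between-powerDist⇔

    powerGraph-isMedianGraph : MedianOperator D → IsMedianGraph powerGraph
    powerGraph-isMedianGraph medianOperator =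
      medianOperator⇒isMedianGraph powerGraph powerDist-isDistance (record
        { median           = powerMedian
        ; median-isMedian  = λ a b c → Equivalence.from IsMedian-powerDist⇔ λ j →
            subst (IsMedian D _ _ _) (sym (coords∘encode≗id _ j)) (median-isMedian _ _ _)
        ; isMedian⇒≡median = λ m → coords-injective λ j →
            trans (isMedian⇒≡median (Equivalence.to IsMedian-powerDist⇔ m j)) (sym (coords∘encode≗id _ j))
        })
      where
      open MedianOperator medianOperator
      powerMedian : Fin (n H ^ k) → Fin (n H ^ k) → Fin (n H ^ k) → Fin (n H ^ k)
      powerMedian a b c = encode λ j → median (coords a j) (coords b j) (coords c j)

    powerGraph-treeDim : IsTree H → TreeDimAtMost powerGraph k
    powerGraph-treeDim isTree = k , ≤-refl , (λ _ → H) , (λ _ → isTree) , coords , λ a b d →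
      Equivalence.to dist-on⇔ , Equivalence.from dist-on⇔
      where
      dist-on⇔ : ∀ {a b d} → Dist (Adj powerGraph) a b d ⇔ Dist PowerAdj (coords a) (coords b) d
      dist-on⇔ = Dist-on⇔ PowerAdj coords encode (encode∘coords≗id) PowerAdj-resp-coords∘encode

module _ (G : Graph) {k : ℕ} (c : Fin (n G) → Fin k) (proper : ∀ u v → Adj G u v → c u ≢ c v) where

  open Star (n G)
  open Power star starDist-isDistance
  open IsDistanceProperties (powerDist-isDistance k) using (InInterval⇔Between)
  open IsDistanceProperties starDist-isDistance using (between-same-ends)

  bag : Fin (n star ^ k) → Subset (n G)
  bag a = tabulate (λ v → does (coords k a (c v) Fin.≟ suc v))

  ∈bag⇔ : ∀ {a v} → v ∈ bag a ⇔ coords k a (c v) ≡ suc v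
  ∈bag⇔ {a} = ∈-tabulate⇔ (λ v → coords k a (c v) Fin.≟ suc v)

  ∈bag-encode : ∀ {v x} → x (c v) ≡ suc v → v ∈ bag (encode k x)
  ∈bag-encode {v} {x} xcv≡v = Equivalence.from ∈bag⇔ (trans (coords∘encode≗id k x (c v)) xcv≡v)

  ∣bag∣≤k : ∀ a → ∣ bag a ∣ ≤ k
  ∣bag∣≤k a = ≤-trans (p⊆q⇒∣p∣≤∣q∣ (λ v∈ → ∈leaves (coords k a) _ (Equivalence.to ∈bag⇔ v∈)))
                      (∣leaves∣≤ (coords k a))

  bag-convex : ∀ v → Convex (Adj (powerGraph k)) (λ a → v ∈ bag a)
  bag-convex v a b w v∈a v∈b w∈I = Equivalence.from ∈bag⇔ (between-same-ends at-cv)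
    where
    at-cv : Between starDist (suc v) (suc v) (coords k w (c v))
    at-cv = subst₂ (λ s t → Between starDist s t (coords k w (c v)))
      (Equivalence.to ∈bag⇔ v∈a) (Equivalence.to ∈bag⇔ v∈b)
      (Equivalence.to (Between-powerDist⇔ k {a} {b} {w}) (Equivalence.to InInterval⇔Between w∈I) (c v))

  hubs : Fin k → Fin (n star)
  hubs _ = zero

  place : Fin (n G) → (Fin k → Fin (n star)) → (Fin k → Fin (n star))
  place v x = updateAt x (c v) (λ _ → suc v)

  place-here : ∀ v x → place v x (c v) ≡ suc v
  place-here v = updateAt-updates (c v)

  place-elsewhere : ∀ u v x → c v ≢ c u → place u x (c v) ≡ x (c v)
  place-elsewhere u v x = updateAt-minimal (c v) (c u) x

  colouringDecomposition : MedianDecomposition G k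
  colouringDecomposition = record
    { M           = powerGraph k
    ; median      = powerGraph-isMedianGraph k starMedian-operator
    ; treeDim     = powerGraph-treeDim k star-isTree
    ; X           = bag
    ; M1          = λ u v uv → encode k (place u (place v hubs)) ,
        ∈bag-encode (place-here u _) ,
        ∈bag-encode (trans (place-elsewhere u v _ (proper u v uv ∘ sym)) (place-here v hubs))
    ; M2-nonempty = λ v → encode k (place v hubs) , ∈bag-encode (place-here v hubs)
    ; M2-convex   = bag-convex
    }

colourable⇒mw≤ : ∀ G k → Colourable G k → mw≤ G k k
colourable⇒mw≤ G k (c , proper) = colouringDecomposition G c proper , ∣bag∣≤k G c proper

lemma5p9 : ∀ (G : Graph) (χ : ℕ) → IsChromaticNumber G χ → mw≤ G χ χ
lemma5p9 G χ (colourable , _) = colourable⇒mw≤ G χ colourable
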